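{- Let $n\ge2$ and let $\mathsf r=[r_1,\dots,r_{2n-2}]$ be a minimal length reflection factorization of $\lambda_n$. Then $\mathsf r$ is tree-like if and only if there exist $a_0,\dots,a_{2n-2}\in\mathbb Z$ such that $r_\ell=(\!(a_{\ell-1},a_\ell)\!)$ and $|a_\ell-a_{\ell-1}|<n$ for $\ell=1,\dots,2n-2$.
   Context: $\widetilde S_n$ is the affine symmetric group: bijections $w:\mathbb Z\to\mathbb Z$ with $w(i+n)=w(i)+n$ and $\sum_{i=1}^n w(i)=\binom{n+1}{2}$, multiplied by composition $(vw)(k)=v(w(k))$. For $i\not\equiv j\pmod n$ the affine reflection $(\!(i,j)\!)$ interchanges $i+kn$ and $j+kn$ for all $k\in\mathbb Z$ and fixes other integers. $\lambda_n$ is given by $\lambda_n(k)=k+n$ if $k\not\equiv0\pmod n$ and $\lambda_n(k)=k-n(n-1)$ if $k\equiv 0\pmod n$; its reflection length is $2n-2$, and a minimal length reflection factorization is a sequence $[r_1,\dots,r_{2n-2}]$ of affine reflections with $r_1\cdots r_{2n-2}=\lambda_n$. Such a factorization is tree-like if there exist integers $a_0,\dots,a_{2n-3},b_1,\dots,b_{2n-2}$ with $r_k=(\!(a_{k-1},b_k)\!)$ and $a_{k-1}<b_k$ for $1\le k\le 2n-2$, and $a_k\equiv b_k\pmod n$ for $1\le k\le 2n-3$. -}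

module Defs where

open import Data.Nat as ℕ using (ℕ; suc)
open import Data.Integer using (ℤ; +_; _+_; _-_; _*_; _<_; ∣_∣)
open import Data.Integer.Divisibility.Signed using (_∣_; _∣?_)
open import Data.Product using (_×_; _,_; ∃)
open import Relation.Nullary using (¬_; yes; no)
open import Relation.Binary.PropositionalEquality using (_≡_)

_≡[mod_]_ : ℤ → ℕ → ℤ → Set
i ≡[mod n ] j = (+ n) ∣ (i - j)

-- the affine reflection ((i,j)) in S̃_n, as a map ℤ → ℤ:
-- sends i + kn ↦ j + kn and j + kn ↦ i + kn, fixes all other integers.
-- (Only meaningful, i.e. a reflection, when i ≢ j mod n.)
aref : ℕ → ℤ → ℤ → ℤ → ℤ
aref n i j k with (+ n) ∣? (k - i) | (+ n) ∣? (k - j)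
... | yes _ | _     = j + (k - i)
... | no _  | yes _ = i + (k - j)
... | no _  | no _  = k

lam : ℕ → ℤ → ℤ
lam n k with (+ n) ∣? k
... | yes _ = k - (+ n) * (+ (n ℕ.∸ 1))
... | no _  = k + (+ n)

-- a sequence of (labels of) reflections, r ℓ = (i , j) meaning ((i,j)),
-- indexed from 1; only indices 1..m are used.
RSeq : Set
RSeq = ℕ → ℤ × ℤ

act : ℕ → ℤ × ℤ → ℤ → ℤ
act n (i , j) = aref n i j

prodR : ℕ → RSeq → ℕ → ℤ → ℤ
prodR n r ℕ.zero k    = k
prodR n r (suc m) k   = prodR n r m (act n (r (suc m)) k)

_≐_ : (ℤ → ℤ) → (ℤ → ℤ) → Set
f ≐ g = ∀ k → f k ≡ g k

-- minimal length reflection factorization of λ_n: 2n-2 affine reflections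
-- r_1,…,r_{2n-2} with r_1 ⋯ r_{2n-2} = λ_n
IsMinReflFact : ℕ → RSeq → Set
IsMinReflFact n r =
  (∀ ℓ → 1 ℕ.≤ ℓ → ℓ ℕ.≤ 2 ℕ.* n ℕ.∸ 2 →
     let (i , j) = r ℓ in ¬ (i ≡[mod n ] j))
  × (prodR n r (2 ℕ.* n ℕ.∸ 2) ≐ lam n)

TreeLike : ℕ → RSeq → Set
TreeLike n r = ∃ λ (a : ℕ → ℤ) → ∃ λ (b : ℕ → ℤ) →
  (∀ k → 1 ℕ.≤ k → k ℕ.≤ 2 ℕ.* n ℕ.∸ 2 →
     (act n (r k) ≐ aref n (a (k ℕ.∸ 1)) (b k)) × (a (k ℕ.∸ 1) < b k))
  × (∀ k → 1 ℕ.≤ k → k ℕ.≤ 2 ℕ.* n ℕ.∸ 3 → a k ≡[mod n ] b k)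

PathLike : ℕ → RSeq → Set
PathLike n r = ∃ λ (a : ℕ → ℤ) →
  ∀ ℓ → 1 ℕ.≤ ℓ → ℓ ℕ.≤ 2 ℕ.* n ℕ.∸ 2 →
    (act n (r ℓ) ≐ aref n (a (ℓ ℕ.∸ 1)) (a ℓ)) × (∣ a ℓ - a (ℓ ℕ.∸ 1) ∣ ℕ.< n)

{-# OPTIONS --safe #-}

-- Read λ_n⁻¹ = r_m ⋯ r_1 (m = 2n − 2) as moving points one reflection at a time. If
-- r_{u+1} = ((c_u, c_{u+1})) for a path c, the orbit of c_0 runs along c_0, c_1, …, c_m, while
-- an orbit outside the class of c_0 is moved at step u+1 only when it lies in the class of
-- c_{u+1}, and then by c_u − c_{u+1}.
--
-- After translating each reflection by a multiple of n, a tree-like factorization is the same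
-- as a strictly increasing path. Along it every other orbit descends; as λ_n⁻¹ c_0 = c_m ≥ c_0,
-- n divides c_0, so λ_n⁻¹ x = x − n for every x outside that class. Following the point that
-- reaches c_{u+1} at time u gives c_{u+1} − c_u ≤ n, and equality would make c_u ≡ c_{u+1}.
--
-- Conversely, if all steps are shorter than n, an orbit moves less than n at each reflection
-- hitting its class. Since λ_n⁻¹ moves non-multiples of n by n and multiples by n(n − 1), every
-- class is hit at least twice and the class of 0 at least n times; but the m reflections make
-- only 2m hits, m of which go to the class of c_0. So every other class is hit exactly twice. If
-- n ∣ c_0, the point reaching c_{u+1} at time u has total displacement −n, made of one jump by
-- c_u − c_{u+1} and another of size < n, so c_{u+1} > c_u: the path is tree-like. Otherwise the
-- class of 0 forces n = 2, where the path descends by 1 twice and its reversal is tree-like.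

module Submission where

open import Defs
open import Data.Nat using (ℕ; _≤_)
open import Function.Bundles using (_⇔_)

open import Data.Bool.Base using (Bool; true; false; _∨_)
open import Data.Empty using (⊥-elim)
open import Data.Integer.Base as ℤ using (ℤ; +_; 0ℤ; _+_; _-_; _*_; -_; ∣_∣)
import Data.Integer.Properties as ℤₚ
open import Data.Integer.Divisibility.Signed
  using (_∣_; _∣?_; divides; ∣-refl; ∣m∣n⇒∣m+n; ∣m∣n⇒∣m-n; ∣m⇒∣-m; ∣m⇒∣m*n; ∣m+n∣n⇒∣m; ∣⇒∣ᵤ)
open import Data.Integer.DivMod using (_%ℕ_; _/ℕ_; a≡a%ℕn+[a/ℕn]*n; n%ℕd<d)
open import Data.Integer.Tactic.RingSolver using (solve-∀)
open import Data.Nat.Base as ℕ using (zero; suc; _<_; _≤′_; ≤′-refl; ≤′-step; z≤n; s≤s)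
import Data.Nat.Divisibility as ℕ∣
import Data.Nat.Properties as ℕₚ
open import Algebra.Properties.CommutativeSemigroup ℕₚ.+-commutativeSemigroup using (interchange)
open import Data.Product using (∃; _×_; _,_; proj₁; proj₂)
open import Data.Sum using (_⊎_; inj₁; inj₂)
import Data.Sum as Sum
open import Function.Base using (_∘_; case_of_)
open import Function.Bundles using (mk⇔)
open import Relation.Binary.Bundles using (Preorder)
import Relation.Binary.Construct.Flip.EqAndOrd as Flip
open import Relation.Binary.PropositionalEquality
open import Relation.Nullary using (¬_; Dec; yes; no; does)
open import Relation.Nullary.Decidable using (_⊎-dec_; decidable-stable; dec-true; dec-false; does-⇔)

private
  -[i-j]≡j-i : ∀ i j → - (i - j) ≡ j - i
  -[i-j]≡j-i = solve-∀

  [i+k]-[j+k]≡i-j : ∀ i j k → (i + k) - (j + k) ≡ i - j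
  [i+k]-[j+k]≡i-j = solve-∀

  [k+i]-[k+j]≡i-j : ∀ k i j → (k + i) - (k + j) ≡ i - j
  [k+i]-[k+j]≡i-j = solve-∀

  [i+k]-i≡k : ∀ i k → (i + k) - i ≡ k
  [i+k]-i≡k = solve-∀

  i+[j-i]≡j : ∀ i j → i + (j - i) ≡ j
  i+[j-i]≡j = solve-∀

  [i+k]-k≡i : ∀ i k → (i + k) - k ≡ i
  [i+k]-k≡i = solve-∀

  i-[i-k]≡k : ∀ i k → i - (i - k) ≡ k
  i-[i-k]≡k = solve-∀

  i-[i+k]≡-k : ∀ i k → i - (i + k) ≡ - k
  i-[i+k]≡-k = solve-∀

  [i-k]+k≡i : ∀ i k → (i - k) + k ≡ i
  [i-k]+k≡i = solve-∀

  s-[u+k]≡[y-u]+[s-[y+k]] : ∀ s u y k → s - (u + k) ≡ (y - u) + (s - (y + k))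
  s-[u+k]≡[y-u]+[s-[y+k]] = solve-∀

  [c+[b-a]]-a′≡[c-a]+[b-a′] : ∀ c b a a′ → (c + (b - a)) - a′ ≡ (c - a) + (b - a′)
  [c+[b-a]]-a′≡[c-a]+[b-a′] = solve-∀

  j+[y-i]≡y+[j-i] : ∀ j y i → j + (y - i) ≡ y + (j - i)
  j+[y-i]≡y+[j-i] = solve-∀

  i-[j+k]≡[i-j]-k : ∀ i j k → i - (j + k) ≡ (i - j) - k
  i-[j+k]≡[i-j]-k = solve-∀

  [y+[j-i]]-j≡y-i : ∀ y i j → (y + (j - i)) - j ≡ y - i
  [y+[j-i]]-j≡y-i = solve-∀

  [y+[j-i]]+[i-j]≡y : ∀ y i j → (y + (j - i)) + (i - j) ≡ y
  [y+[j-i]]+[i-j]≡y = solve-∀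

-- _≡[mod_]_ unfolds to divisibility of a difference, so unification never recovers its
-- endpoints: the lemmas below take them explicitly, and case splits on congruences use
-- case_of_ rather than with, which would normalise the goal.

_≡[mod_]?_ : ∀ i n j → Dec (i ≡[mod n ] j)
i ≡[mod n ]? j = + n ∣? (i - j)

module _ {n : ℕ} where

  ≡mod-refl : ∀ i → i ≡[mod n ] i
  ≡mod-refl i = divides 0ℤ (ℤₚ.+-inverseʳ i)

  ≡mod-sym : ∀ i j → i ≡[mod n ] j → j ≡[mod n ] i
  ≡mod-sym i j i≡j = subst (+ n ∣_) (-[i-j]≡j-i i j) (∣m⇒∣-m i≡j)

  ≡mod-trans : ∀ i j k → i ≡[mod n ] j → j ≡[mod n ] k → i ≡[mod n ] k
  ≡mod-trans i j k i≡j j≡k = subst (+ n ∣_) (ℤₚ.+-minus-telescope i j k) (∣m∣n⇒∣m+n i≡j j≡k)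

  ≡mod-+ʳ : ∀ i j k → i ≡[mod n ] j → (i + k) ≡[mod n ] (j + k)
  ≡mod-+ʳ i j k = subst (+ n ∣_) (sym ([i+k]-[j+k]≡i-j i j k))

  ≡mod-+-multiple : ∀ k {K} → + n ∣ K → k ≡[mod n ] (k + K)
  ≡mod-+-multiple k {K} n∣K = ≡mod-sym (k + K) k (subst (+ n ∣_) (sym ([i+k]-i≡k k K)) n∣K)

  multiple<n⇒≡0 : ∀ {d} → + n ∣ d → ∣ d ∣ < n → d ≡ 0ℤ
  multiple<n⇒≡0 {d} n∣d ∣d∣<n with ∣ d ∣ in ∣d∣≡
  ... | zero  = ℤₚ.∣i∣≡0⇒i≡0 ∣d∣≡
  ... | suc _ = ⊥-elim (ℕ∣.>⇒∤ ∣d∣<n (subst (n ℕ∣.∣_) ∣d∣≡ (∣⇒∣ᵤ n∣d)))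

  residue-injective : ∀ b {i j} → i < n → j < n → (b + + i) ≡[mod n ] (b + + j) → i ≡ j
  residue-injective b {i} {j} i<n j<n b+i≡b+j =
    ℤₚ.+-injective (ℤₚ.i-j≡0⇒i≡j (+ i) (+ j) (multiple<n⇒≡0 n∣i-j ∣i-j∣<n))
    where
    n∣i-j : + n ∣ + i - + j
    n∣i-j = subst (+ n ∣_) ([k+i]-[k+j]≡i-j b (+ i) (+ j)) b+i≡b+j
    ∣i-j∣<n : ∣ + i - + j ∣ < n
    ∣i-j∣<n = subst (_< n) (cong ∣_∣ (sym (ℤₚ.[+m]-[+n]≡m⊖n i j)))
                (ℕₚ.≤-<-trans (ℤₚ.∣m⊝n∣≤m⊔n i j) (ℕₚ.⊔-lub i<n j<n))

  residue : ∀ .{{_ : ℕ.NonZero n}} b x → ∃ λ i → i < n × (b + + i) ≡[mod n ] x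
  residue b x = r , n%ℕd<d (x - b) n , ≡mod-sym x (b + + r) (divides q x-[b+r]≡q*n)
    where
    r = (x - b) %ℕ n
    q = (x - b) /ℕ n
    x-[b+r]≡q*n : x - (b + + r) ≡ q * + n
    x-[b+r]≡q*n = begin
      x - (b + + r)             ≡⟨ i-[j+k]≡[i-j]-k x b (+ r) ⟩
      (x - b) - + r             ≡⟨ cong (_- + r) (a≡a%ℕn+[a/ℕn]*n (x - b) n) ⟩
      (+ r + q * + n) - + r     ≡⟨ [i+k]-i≡k (+ r) (q * + n) ⟩
      q * + n                   ∎
      where open ≡-Reasoning

∑ : ℕ → (ℕ → ℕ) → ℕ
∑ zero    f = 0
∑ (suc k) f = ∑ k f ℕ.+ f k

syntax ∑ k (λ i → e) = ∑[ i < k ] e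

∑-cong : ∀ k {f g} → (∀ i → f i ≡ g i) → ∑ k f ≡ ∑ k g
∑-cong zero    f≗g = refl
∑-cong (suc k) f≗g = cong₂ ℕ._+_ (∑-cong k f≗g) (f≗g k)

∑-mono-≤ : ∀ k {f g} → (∀ i → i < k → f i ≤ g i) → ∑ k f ≤ ∑ k g
∑-mono-≤ zero    f≤g = z≤n
∑-mono-≤ (suc k) f≤g = ℕₚ.+-mono-≤ (∑-mono-≤ k (λ i i<k → f≤g i (ℕₚ.m<n⇒m<1+n i<k))) (f≤g k ℕₚ.≤-refl)

∑-const : ∀ k c → ∑[ i < k ] c ≡ k ℕ.* c
∑-const zero    c = refl
∑-const (suc k) c = trans (cong (ℕ._+ c) (∑-const k c)) (ℕₚ.+-comm (k ℕ.* c) c)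

∑-distrib-+ : ∀ k f g → ∑[ i < k ] (f i ℕ.+ g i) ≡ ∑ k f ℕ.+ ∑ k g
∑-distrib-+ zero    f g = refl
∑-distrib-+ (suc k) f g =
  trans (cong (ℕ._+ (f k ℕ.+ g k)) (∑-distrib-+ k f g)) (interchange (∑ k f) (∑ k g) (f k) (g k))

∑-swap-≤ : ∀ k t (g : ℕ → ℕ → ℕ) {c} → (∀ u → u < t → ∑[ i < k ] g i u ≤ c) →
           ∑[ i < k ] ∑[ u < t ] g i u ≤ t ℕ.* c
∑-swap-≤ k zero    g h = ℕₚ.≤-reflexive (trans (∑-const k 0) (ℕₚ.*-zeroʳ k))
∑-swap-≤ k (suc t) g {c} h = begin
  ∑[ i < k ] (∑[ u < t ] g i u ℕ.+ g i t)
    ≡⟨ ∑-distrib-+ k (λ i → ∑[ u < t ] g i u) (λ i → g i t) ⟩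
  ∑[ i < k ] ∑[ u < t ] g i u ℕ.+ ∑[ i < k ] g i t
    ≤⟨ ℕₚ.+-mono-≤ (∑-swap-≤ k t g (λ u u<t → h u (ℕₚ.m<n⇒m<1+n u<t))) (h t ℕₚ.≤-refl) ⟩
  t ℕ.* c ℕ.+ c
    ≡⟨ ℕₚ.+-comm (t ℕ.* c) c ⟩
  suc t ℕ.* c ∎
  where open ℕₚ.≤-Reasoning

∑-average : ∀ k {f c} → (∀ i → i < k → c ≤ f i) → ∑ k f ≤ k ℕ.* c → ∀ i → i < k → f i ≤ c
∑-average (suc k) {f} {c} c≤f ∑≤ i i<1+k = case ℕₚ.m<1+n⇒m<n∨m≡n i<1+k of λ where
    (inj₁ i<k) → ∑-average k c≤f-below ∑k≤k*c i i<k
    (inj₂ i≡k) → subst (λ j → f j ≤ c) (sym i≡k) fk≤c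
  where
  c≤f-below : ∀ i → i < k → c ≤ f i
  c≤f-below i i<k = c≤f i (ℕₚ.m<n⇒m<1+n i<k)
  ∑≤k*c+c : ∑ k f ℕ.+ f k ≤ k ℕ.* c ℕ.+ c
  ∑≤k*c+c = ℕₚ.≤-trans ∑≤ (ℕₚ.≤-reflexive (ℕₚ.+-comm c (k ℕ.* c)))
  k*c≤∑k : k ℕ.* c ≤ ∑ k f
  k*c≤∑k = ℕₚ.≤-trans (ℕₚ.≤-reflexive (sym (∑-const k c))) (∑-mono-≤ k c≤f-below)
  ∑k≤k*c : ∑ k f ≤ k ℕ.* c
  ∑k≤k*c = ℕₚ.+-cancelʳ-≤ c (∑ k f) (k ℕ.* c) (ℕₚ.≤-trans (ℕₚ.+-monoʳ-≤ (∑ k f) (c≤f k ℕₚ.≤-refl)) ∑≤k*c+c)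
  fk≤c : f k ≤ c
  fk≤c = ℕₚ.+-cancelˡ-≤ (k ℕ.* c) (f k) c (ℕₚ.≤-trans (ℕₚ.+-monoˡ-≤ (f k) k*c≤∑k) ∑≤k*c+c)

𝟙 : Bool → ℕ
𝟙 true  = 1
𝟙 false = 0

𝟙-∨ : ∀ a b → 𝟙 (a ∨ b) ≤ 𝟙 a ℕ.+ 𝟙 b
𝟙-∨ true  b = s≤s z≤n
𝟙-∨ false b = ℕₚ.≤-refl

∑-𝟙-unique : ∀ k {P : ℕ → Set} (P? : ∀ i → Dec (P i)) →
             (∀ i i′ → i < k → i′ < k → P i → P i′ → i ≡ i′) → ∑[ i < k ] 𝟙 (does (P? i)) ≤ 1
∑-𝟙-unique zero    P? unique = z≤n
∑-𝟙-unique (suc k) P? unique with P? k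
... | yes Pk = ℕₚ.+-monoˡ-≤ 1
  (ℕₚ.≤-trans (∑-mono-≤ k none-below) (ℕₚ.≤-reflexive (trans (∑-const k 0) (ℕₚ.*-zeroʳ k))))
  where
  none-below : ∀ i → i < k → 𝟙 (does (P? i)) ≤ 0
  none-below i i<k with P? i
  ... | yes Pi = ⊥-elim (ℕₚ.<-irrefl (unique i k (ℕₚ.m<n⇒m<1+n i<k) ℕₚ.≤-refl Pi Pk) i<k)
  ... | no _   = z≤n
... | no _   = ℕₚ.≤-trans (ℕₚ.≤-reflexive (ℕₚ.+-identityʳ _))
                 (∑-𝟙-unique k P? (λ i i′ i<k i′<k → unique i i′ (ℕₚ.m<n⇒m<1+n i<k) (ℕₚ.m<n⇒m<1+n i′<k)))

∣i∣<n⇒-n<i<n : ∀ {i n} → ∣ i ∣ < n → - + n ℤ.< i × i ℤ.< + n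
∣i∣<n⇒-n<i<n {+ k}      {suc _} k<n = ℤ.-<+ , ℤ.+<+ k<n
∣i∣<n⇒-n<i<n {ℤ.-[1+ k ]} {n}   k<n = ℤₚ.neg-mono-< (ℤ.+<+ k<n) , ℤ.-<+

∣i-j∣<n⇒i<j+n : ∀ {i j n} → ∣ i - j ∣ < n → i ℤ.< j + + n
∣i-j∣<n⇒i<j+n {i} {j} {n} ∣i-j∣<n = begin-strict
  i              ≡⟨ i+[j-i]≡j j i ⟨
  j + (i - j)    <⟨ ℤₚ.+-monoʳ-< j (proj₂ (∣i∣<n⇒-n<i<n ∣i-j∣<n)) ⟩
  j + + n        ∎
  where open ℤₚ.≤-Reasoning

∣i-[j+n]∣<n⇒j<i : ∀ {i j n} → ∣ i - (j + + n) ∣ < n → j ℤ.< i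
∣i-[j+n]∣<n⇒j<i {i} {j} {n} ∣i-[j+n]∣<n = begin-strict
  j                        ≡⟨ [i+k]-k≡i j (+ n) ⟨
  (j + + n) - + n          <⟨ ℤₚ.+-monoʳ-< (j + + n) (proj₁ (∣i∣<n⇒-n<i<n ∣i-[j+n]∣<n)) ⟩
  (j + + n) + (i - (j + + n)) ≡⟨ i+[j-i]≡j (j + + n) i ⟩
  i                        ∎
  where open ℤₚ.≤-Reasoning

i<j<i+n⇒∣j-i∣<n : ∀ {i j n} → i ℤ.< j → j ℤ.< i + + n → ∣ j - i ∣ < n
i<j<i+n⇒∣j-i∣<n {i} {j} {n} i<j j<i+n = ℤₚ.drop‿+<+ (begin-strict
  + ∣ j - i ∣    ≡⟨ cong +_ (ℤₚ.∣i-j∣≡∣j-i∣ j i) ⟩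
  + ∣ i - j ∣    ≡⟨ ℤₚ.∣-∣-≤ (ℤₚ.<⇒≤ i<j) ⟩
  j - i          <⟨ ℤₚ.+-monoˡ-< (- i) j<i+n ⟩
  (i + + n) - i  ≡⟨ [i+k]-i≡k i (+ n) ⟩
  + n            ∎)
  where open ℤₚ.≤-Reasoning

∣i-k∣≤∣i-j∣+∣j-k∣ : ∀ i j k → ∣ i - k ∣ ≤ ∣ i - j ∣ ℕ.+ ∣ j - k ∣
∣i-k∣≤∣i-j∣+∣j-k∣ i j k =
  subst (λ d → ∣ d ∣ ≤ ∣ i - j ∣ ℕ.+ ∣ j - k ∣) (ℤₚ.+-minus-telescope i j k) (ℤₚ.∣i+j∣≤∣i∣+∣j∣ (i - j) (j - k))

module _ {a ℓ₁ ℓ₂} (P : Preorder a ℓ₁ ℓ₂) (f : ℕ → Preorder.Carrier P) where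

  open Preorder P using (_≲_) renaming (refl to ≲-refl; trans to ≲-trans)

  chain : ∀ {s t} → (∀ u → u < t → f u ≲ f (suc u)) → s ≤′ t → f s ≲ f t
  chain step ≤′-refl           = ≲-refl
  chain step (≤′-step {t} s≤t) =
    ≲-trans (chain (λ u u<t → step u (ℕₚ.m<n⇒m<1+n u<t)) s≤t) (step t ℕₚ.≤-refl)

walk-bound : ∀ (f : ℕ → ℤ) (w : ℕ → ℕ) D {s t} → (∀ u → u < t → ∣ f (suc u) - f u ∣ ≤ D ℕ.* w u) →
             s ≤′ t → ∣ f t - f s ∣ ℕ.+ D ℕ.* ∑ s w ≤ D ℕ.* ∑ t w
walk-bound f w D {s} step ≤′-refl = ℕₚ.≤-reflexive (cong (λ d → ∣ d ∣ ℕ.+ D ℕ.* ∑ s w) (ℤₚ.+-inverseʳ (f s)))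
walk-bound f w D {s} step (≤′-step {t} s≤t) = begin
  ∣ f (suc t) - f s ∣ ℕ.+ D ℕ.* ∑ s w
    ≤⟨ ℕₚ.+-monoˡ-≤ _ (∣i-k∣≤∣i-j∣+∣j-k∣ (f (suc t)) (f t) (f s)) ⟩
  ∣ f (suc t) - f t ∣ ℕ.+ ∣ f t - f s ∣ ℕ.+ D ℕ.* ∑ s w
    ≡⟨ ℕₚ.+-assoc ∣ f (suc t) - f t ∣ _ _ ⟩
  ∣ f (suc t) - f t ∣ ℕ.+ (∣ f t - f s ∣ ℕ.+ D ℕ.* ∑ s w)
    ≤⟨ ℕₚ.+-mono-≤ (step t ℕₚ.≤-refl) (walk-bound f w D (λ u u<t → step u (ℕₚ.m<n⇒m<1+n u<t)) s≤t) ⟩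
  D ℕ.* w t ℕ.+ D ℕ.* ∑ t w
    ≡⟨ ℕₚ.+-comm (D ℕ.* w t) _ ⟩
  D ℕ.* ∑ t w ℕ.+ D ℕ.* w t
    ≡⟨ ℕₚ.*-distribˡ-+ D (∑ t w) (w t) ⟨
  D ℕ.* ∑ (suc t) w ∎
  where open ℕₚ.≤-Reasoning

-- Affine reflections

data Position (n : ℕ) (i j y : ℤ) : Set where
  at-i      : y ≡[mod n ] i → Position n i j y
  at-j      : ¬ y ≡[mod n ] i → y ≡[mod n ] j → Position n i j y
  elsewhere : ¬ y ≡[mod n ] i → ¬ y ≡[mod n ] j → Position n i j y

position : ∀ n i j y → Position n i j y
position n i j y with y ≡[mod n ]? i | y ≡[mod n ]? j
... | yes y≡i | _       = at-i y≡i
... | no y≢i  | yes y≡j = at-j y≢i y≡j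
... | no y≢i  | no y≢j  = elsewhere y≢i y≢j

module _ {n : ℕ} {i j : ℤ} where

  aref-≡ˡ : ∀ y → y ≡[mod n ] i → aref n i j y ≡ y + (j - i)
  aref-≡ˡ y y≡i with + n ∣? (y - i) | + n ∣? (y - j)
  ... | yes _  | _ = j+[y-i]≡y+[j-i] j y i
  ... | no y≢i | _ = ⊥-elim (y≢i y≡i)

  aref-≡ʳ : ∀ y → ¬ y ≡[mod n ] i → y ≡[mod n ] j → aref n i j y ≡ y + (i - j)
  aref-≡ʳ y y≢i y≡j with + n ∣? (y - i) | + n ∣? (y - j)
  ... | yes y≡i | _      = ⊥-elim (y≢i y≡i)
  ... | no _    | yes _  = j+[y-i]≡y+[j-i] i y j
  ... | no _    | no y≢j = ⊥-elim (y≢j y≡j)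

  aref-fixes : ∀ y → ¬ y ≡[mod n ] i → ¬ y ≡[mod n ] j → aref n i j y ≡ y
  aref-fixes y y≢i y≢j with + n ∣? (y - i) | + n ∣? (y - j)
  ... | yes y≡i | _       = ⊥-elim (y≢i y≡i)
  ... | no _    | yes y≡j = ⊥-elim (y≢j y≡j)
  ... | no _    | no _    = refl

  aref-left : aref n i j i ≡ j
  aref-left = trans (aref-≡ˡ i (≡mod-refl i)) (i+[j-i]≡j i j)

  aref-right : ¬ i ≡[mod n ] j → aref n i j j ≡ i
  aref-right i≢j = trans (aref-≡ʳ j (i≢j ∘ ≡mod-sym j i) (≡mod-refl j)) (i+[j-i]≡j j i)

  aref-cong : ∀ y z → y ≡[mod n ] z → aref n i j y ≡[mod n ] aref n i j z
  aref-cong y z y≡z = case position n i j y of λ where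
      (at-i y≡i) → subst₂ _≡[mod n ]_ (sym (aref-≡ˡ y y≡i)) (sym (aref-≡ˡ z (z≡ i y≡i)))
                     (≡mod-+ʳ y z (j - i) y≡z)
      (at-j y≢i y≡j) → subst₂ _≡[mod n ]_ (sym (aref-≡ʳ y y≢i y≡j)) (sym (aref-≡ʳ z (z≢ i y≢i) (z≡ j y≡j)))
                         (≡mod-+ʳ y z (i - j) y≡z)
      (elsewhere y≢i y≢j) → subst₂ _≡[mod n ]_ (sym (aref-fixes y y≢i y≢j))
                              (sym (aref-fixes z (z≢ i y≢i) (z≢ j y≢j))) y≡z
    where
    z≡ : ∀ k → y ≡[mod n ] k → z ≡[mod n ] k
    z≡ k = ≡mod-trans z y k (≡mod-sym y z y≡z)
    z≢ : ∀ k → ¬ y ≡[mod n ] k → ¬ z ≡[mod n ] k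
    z≢ k y≢k = y≢k ∘ ≡mod-trans y z k y≡z

  aref-moves≤ : ∀ y → ∣ aref n i j y - y ∣ ≤ ∣ j - i ∣
  aref-moves≤ y = case position n i j y of λ where
      (at-i y≡i) → ℕₚ.≤-reflexive (begin
        ∣ aref n i j y - y ∣   ≡⟨ cong (λ a → ∣ a - y ∣) (aref-≡ˡ y y≡i) ⟩
        ∣ y + (j - i) - y ∣    ≡⟨ cong ∣_∣ ([i+k]-i≡k y (j - i)) ⟩
        ∣ j - i ∣              ∎)
      (at-j y≢i y≡j) → ℕₚ.≤-reflexive (begin
        ∣ aref n i j y - y ∣   ≡⟨ cong (λ a → ∣ a - y ∣) (aref-≡ʳ y y≢i y≡j) ⟩
        ∣ y + (i - j) - y ∣    ≡⟨ cong ∣_∣ ([i+k]-i≡k y (i - j)) ⟩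
        ∣ i - j ∣              ≡⟨ ℤₚ.∣i-j∣≡∣j-i∣ i j ⟩
        ∣ j - i ∣              ∎)
      (elsewhere y≢i y≢j) → ℕₚ.≤-trans (ℕₚ.≤-reflexive (begin
        ∣ aref n i j y - y ∣   ≡⟨ cong (λ a → ∣ a - y ∣) (aref-fixes y y≢i y≢j) ⟩
        ∣ y - y ∣              ≡⟨ cong ∣_∣ (ℤₚ.+-inverseʳ y) ⟩
        0                      ∎)) z≤n
    where open ≡-Reasoning

  aref-within-class : i ≡[mod n ] j → ∀ y → aref n i j y ≡[mod n ] y
  aref-within-class i≡j y = case position n i j y of λ where
    (at-i y≡i) → subst (_≡[mod n ] y) (sym (aref-≡ˡ y y≡i))
                   (subst (+ n ∣_) (sym ([i+k]-i≡k y (j - i))) (≡mod-sym i j i≡j))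
    (at-j y≢i y≡j) → subst (_≡[mod n ] y) (sym (aref-≡ʳ y y≢i y≡j))
                       (subst (+ n ∣_) (sym ([i+k]-i≡k y (i - j))) i≡j)
    (elsewhere y≢i y≢j) → subst (_≡[mod n ] y) (sym (aref-fixes y y≢i y≢j)) (≡mod-refl y)

  module _ (i≢j : ¬ i ≡[mod n ] j) where

    aref-involutive : ∀ y → aref n i j (aref n i j y) ≡ y
    aref-involutive y = case position n i j y of λ where
        (at-i y≡i) → begin
          aref n i j (aref n i j y)   ≡⟨ cong (aref n i j) (aref-≡ˡ y y≡i) ⟩
          aref n i j (y + (j - i))    ≡⟨ aref-≡ʳ _ (moved-off i j i≢j y≡i) (moved-to i j y≡i) ⟩
          y + (j - i) + (i - j)       ≡⟨ [y+[j-i]]+[i-j]≡y y i j ⟩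
          y                           ∎
        (at-j y≢i y≡j) → begin
          aref n i j (aref n i j y)   ≡⟨ cong (aref n i j) (aref-≡ʳ y y≢i y≡j) ⟩
          aref n i j (y + (i - j))    ≡⟨ aref-≡ˡ _ (moved-to j i y≡j) ⟩
          y + (i - j) + (j - i)       ≡⟨ [y+[j-i]]+[i-j]≡y y j i ⟩
          y                           ∎
        (elsewhere y≢i y≢j) →
          trans (cong (aref n i j) (aref-fixes y y≢i y≢j)) (aref-fixes y y≢i y≢j)
      where
      open ≡-Reasoning
      moved-to : ∀ k l → y ≡[mod n ] k → (y + (l - k)) ≡[mod n ] l
      moved-to k l y≡k = subst (+ n ∣_) (sym ([y+[j-i]]-j≡y-i y k l)) y≡k
      moved-off : ∀ k l → ¬ k ≡[mod n ] l → y ≡[mod n ] k → ¬ (y + (l - k)) ≡[mod n ] k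
      moved-off k l k≢l y≡k y′≡k =
        k≢l (≡mod-trans k (y + (l - k)) l (≡mod-sym (y + (l - k)) k y′≡k) (moved-to k l y≡k))

    aref-cong⁻¹ : ∀ y z → aref n i j y ≡[mod n ] aref n i j z → y ≡[mod n ] z
    aref-cong⁻¹ y z p =
      subst₂ _≡[mod n ]_ (aref-involutive y) (aref-involutive z) (aref-cong (aref n i j y) (aref n i j z) p)

aref-comm : ∀ {n i j} → ¬ i ≡[mod n ] j → aref n i j ≐ aref n j i
aref-comm {n} {i} {j} i≢j y = case position n i j y of λ where
  (at-i y≡i) → trans (aref-≡ˡ y y≡i) (sym (aref-≡ʳ y (i≢j ∘ ≡mod-trans i y j (≡mod-sym y i y≡i)) y≡i))
  (at-j y≢i y≡j) → trans (aref-≡ʳ y y≢i y≡j) (sym (aref-≡ˡ y y≡j))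
  (elsewhere y≢i y≢j) → trans (aref-fixes y y≢i y≢j) (sym (aref-fixes y y≢j y≢i))

module _ {n : ℕ} {i j K : ℤ} (n∣K : + n ∣ K) where

  private
    shift : ∀ y k → y ≡[mod n ] k → y ≡[mod n ] (k + K)
    shift y k y≡k = ≡mod-trans y k (k + K) y≡k (≡mod-+-multiple k n∣K)

    unshift : ∀ y k → y ≡[mod n ] (k + K) → y ≡[mod n ] k
    unshift y k y≡k+K = ≡mod-trans y (k + K) k y≡k+K (≡mod-sym k (k + K) (≡mod-+-multiple k n∣K))

  aref-translate : aref n (i + K) (j + K) ≐ aref n i j
  aref-translate y = case position n i j y of λ where
      (at-i y≡i) → begin
        aref n (i + K) (j + K) y  ≡⟨ aref-≡ˡ y (shift y i y≡i) ⟩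
        y + ((j + K) - (i + K))   ≡⟨ cong (_+_ y) ([i+k]-[j+k]≡i-j j i K) ⟩
        y + (j - i)               ≡⟨ aref-≡ˡ y y≡i ⟨
        aref n i j y              ∎
      (at-j y≢i y≡j) → begin
        aref n (i + K) (j + K) y  ≡⟨ aref-≡ʳ y (y≢i ∘ unshift y i) (shift y j y≡j) ⟩
        y + ((i + K) - (j + K))   ≡⟨ cong (_+_ y) ([i+k]-[j+k]≡i-j i j K) ⟩
        y + (i - j)               ≡⟨ aref-≡ʳ y y≢i y≡j ⟨
        aref n i j y              ∎
      (elsewhere y≢i y≢j) →
        trans (aref-fixes y (y≢i ∘ unshift y i) (y≢j ∘ unshift y j)) (sym (aref-fixes y y≢i y≢j))
    where open ≡-Reasoning

aref-apart : ∀ {n i j i′ j′} → aref n i j ≐ aref n i′ j′ → ¬ i ≡[mod n ] j → ¬ i′ ≡[mod n ] j′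
aref-apart {n} {i} {j} {i′} {j′} same i≢j i′≡j′ = i≢j (≡mod-sym j i j≡i)
  where
  j≡i : j ≡[mod n ] i
  j≡i = subst (_≡[mod n ] i) (trans (sym (same i)) (aref-left {n} {i} {j})) (aref-within-class i′≡j′ i)

-- Products of reflections and their orbits

Reflections : ℕ → RSeq → ℕ → Set
Reflections n r m = ∀ u → u < m → ¬ proj₁ (r (suc u)) ≡[mod n ] proj₂ (r (suc u))

revProdR : ℕ → RSeq → ℕ → ℤ → ℤ
revProdR n r zero    y = y
revProdR n r (suc t) y = act n (r (suc t)) (revProdR n r t y)

module _ {n : ℕ} {r : RSeq} where

  revProdR-cong : ∀ t y z → y ≡[mod n ] z → revProdR n r t y ≡[mod n ] revProdR n r t z
  revProdR-cong zero    y z y≡z = y≡z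
  revProdR-cong (suc t) y z y≡z = aref-cong (revProdR n r t y) (revProdR n r t z) (revProdR-cong t y z y≡z)

  module _ {m : ℕ} (reflections : Reflections n r m) where

    revProdR-cong⁻¹ : ∀ {t} → t ≤ m → ∀ y z → revProdR n r t y ≡[mod n ] revProdR n r t z → y ≡[mod n ] z
    revProdR-cong⁻¹ {zero}  _   y z p = p
    revProdR-cong⁻¹ {suc t} t<m y z p =
      revProdR-cong⁻¹ (ℕₚ.<⇒≤ t<m) y z (aref-cong⁻¹ (reflections t t<m) (revProdR n r t y) (revProdR n r t z) p)

    prodR-revProdR : ∀ {t} → t ≤ m → ∀ y → prodR n r t (revProdR n r t y) ≡ y
    prodR-revProdR {zero}  _   y = refl
    prodR-revProdR {suc t} t<m y =
      trans (cong (prodR n r t) (aref-involutive (reflections t t<m) _)) (prodR-revProdR (ℕₚ.<⇒≤ t<m) y)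

    revProdR-prodR : ∀ {t} → t ≤ m → ∀ y → revProdR n r t (prodR n r t y) ≡ y
    revProdR-prodR {zero}  _   y = refl
    revProdR-prodR {suc t} t<m y =
      trans (cong (act n (r (suc t))) (revProdR-prodR (ℕₚ.<⇒≤ t<m) _)) (aref-involutive (reflections t t<m) y)

IsPath : ℕ → RSeq → ℕ → (ℕ → ℤ) → Set
IsPath n r m c = ∀ u → u < m → act n (r (suc u)) ≐ aref n (c u) (c (suc u))

module Path {n m : ℕ} {r : RSeq} (reflections : Reflections n r m) {c : ℕ → ℤ} (path : IsPath n r m c) where

  orbit : ℕ → ℤ → ℤ
  orbit = revProdR n r

  apart : ∀ u → u < m → ¬ c u ≡[mod n ] c (suc u)
  apart u u<m = aref-apart (path u u<m) (reflections u u<m)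

  orbit-step : ∀ {u} → u < m → ∀ x → orbit (suc u) x ≡ aref n (c u) (c (suc u)) (orbit u x)
  orbit-step {u} u<m x = path u u<m (orbit u x)

  orbit-c₀ : ∀ {t} → t ≤ m → orbit t (c 0) ≡ c t
  orbit-c₀ {zero}  _   = refl
  orbit-c₀ {suc t} t<m = begin
    orbit (suc t) (c 0)                         ≡⟨ orbit-step t<m (c 0) ⟩
    aref n (c t) (c (suc t)) (orbit t (c 0))    ≡⟨ cong (aref n (c t) (c (suc t))) (orbit-c₀ (ℕₚ.<⇒≤ t<m)) ⟩
    aref n (c t) (c (suc t)) (c t)              ≡⟨ aref-left {n} ⟩
    c (suc t)                                   ∎
    where open ≡-Reasoning

  orbit-avoids : ∀ x → ¬ x ≡[mod n ] c 0 → ∀ {t} → t ≤ m → ¬ orbit t x ≡[mod n ] c t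
  orbit-avoids x x≢c₀ {t} t≤m xₜ≡cₜ = x≢c₀ (revProdR-cong⁻¹ reflections t≤m x (c 0)
    (subst (orbit t x ≡[mod n ]_) (sym (orbit-c₀ t≤m)) xₜ≡cₜ))

  orbit-jumps : ∀ x → ¬ x ≡[mod n ] c 0 → ∀ {u} → u < m → orbit u x ≡[mod n ] c (suc u) →
                orbit (suc u) x ≡ orbit u x + (c u - c (suc u))
  orbit-jumps x x≢c₀ u<m xᵤ≡c = trans (orbit-step u<m x) (aref-≡ʳ _ (orbit-avoids x x≢c₀ (ℕₚ.<⇒≤ u<m)) xᵤ≡c)

  orbit-rests : ∀ x {u} → u < m → ¬ orbit u x ≡[mod n ] c u → ¬ orbit u x ≡[mod n ] c (suc u) →
                orbit (suc u) x ≡ orbit u x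
  orbit-rests x u<m xᵤ≢cᵤ xᵤ≢cₛ = trans (orbit-step u<m x) (aref-fixes _ xᵤ≢cᵤ xᵤ≢cₛ)

  source : ℕ → ℤ
  source u = prodR n r u (c (suc u))

  orbit-source : ∀ {u} → u < m → orbit u (source u) ≡ c (suc u)
  orbit-source u<m = revProdR-prodR reflections (ℕₚ.<⇒≤ u<m) _

  orbit-source-step : ∀ {u} → u < m → orbit (suc u) (source u) ≡ c u
  orbit-source-step {u} u<m = begin
    orbit (suc u) (source u)                          ≡⟨ orbit-step u<m (source u) ⟩
    aref n (c u) (c (suc u)) (orbit u (source u))     ≡⟨ cong (aref n (c u) (c (suc u))) (orbit-source u<m) ⟩
    aref n (c u) (c (suc u)) (c (suc u))              ≡⟨ aref-right (apart u u<m) ⟩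
    c u                                               ∎
    where open ≡-Reasoning

  source≢c₀ : ∀ {u} → u < m → ¬ source u ≡[mod n ] c 0
  source≢c₀ {u} u<m src≡c₀ = apart u u<m (≡mod-sym (c (suc u)) (c u)
    (subst₂ _≡[mod n ]_ (orbit-source u<m) (orbit-c₀ (ℕₚ.<⇒≤ u<m)) (revProdR-cong u (source u) (c 0) src≡c₀)))

-- Minimal factorizations of λ_n

module _ {n : ℕ} where

  lam-preimage-∤ : ∀ y {x} → lam n y ≡ x → ¬ + n ∣ x → y + + n ≡ x
  lam-preimage-∤ y lam[y]≡x n∤x with + n ∣? y
  ... | yes n∣y = ⊥-elim (n∤x (subst (+ n ∣_) lam[y]≡x (∣m∣n⇒∣m-n n∣y (∣m⇒∣m*n (+ (n ℕ.∸ 1)) ∣-refl))))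
  ... | no _    = lam[y]≡x

  lam-preimage-∣ : ∀ y {x} → lam n y ≡ x → + n ∣ x → y - + n * + (n ℕ.∸ 1) ≡ x
  lam-preimage-∣ y lam[y]≡x n∣x with + n ∣? y
  ... | yes _   = lam[y]≡x
  ... | no n∤y  = ⊥-elim (n∤y (∣m+n∣n⇒∣m (subst (+ n ∣_) (sym lam[y]≡x) n∣x) ∣-refl))

module Factorization {B : ℕ} {r : RSeq} (hmin : IsMinReflFact (suc B) r) where

  n m : ℕ
  n = suc B
  m = 2 ℕ.* n ℕ.∸ 2

  m≡B*2 : m ≡ B ℕ.* 2
  m≡B*2 = trans (cong (ℕ._∸ 2) (ℕₚ.*-suc 2 B)) (trans (ℕₚ.m+n∸m≡n 2 (2 ℕ.* B)) (ℕₚ.*-comm 2 B))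

  reflections : Reflections n r m
  reflections u u<m = proj₁ hmin (suc u) (s≤s z≤n) u<m

  lam-revProdR : ∀ x → lam n (revProdR n r m x) ≡ x
  lam-revProdR x = trans (sym (proj₂ hmin (revProdR n r m x))) (prodR-revProdR reflections ℕₚ.≤-refl x)

  revProdR-end-∤ : ∀ {x} → ¬ + n ∣ x → revProdR n r m x + + n ≡ x
  revProdR-end-∤ {x} = lam-preimage-∤ (revProdR n r m x) (lam-revProdR x)

  revProdR-end-∣ : ∀ {x} → + n ∣ x → revProdR n r m x - + n * + B ≡ x
  revProdR-end-∣ {x} = lam-preimage-∣ (revProdR n r m x) (lam-revProdR x)

  module Increasing {c : ℕ → ℤ} (path : IsPath n r m c) (increasing : ∀ u → u < m → c u ℤ.< c (suc u)) where

    open Path {r = r} reflections path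

    orbit-descends : ∀ x → ¬ x ≡[mod n ] c 0 → ∀ {u} → u < m → orbit (suc u) x ℤ.≤ orbit u x
    orbit-descends x x≢c₀ {u} u<m = case orbit u x ≡[mod n ]? c (suc u) of λ where
        (yes xᵤ≡c) → begin
          orbit (suc u) x                   ≡⟨ orbit-jumps x x≢c₀ u<m xᵤ≡c ⟩
          orbit u x + (c u - c (suc u))     ≤⟨ ℤₚ.+-monoʳ-≤ (orbit u x) (ℤₚ.i≤j⇒i-j≤0 (ℤₚ.<⇒≤ (increasing u u<m))) ⟩
          orbit u x + 0ℤ                    ≡⟨ ℤₚ.+-identityʳ (orbit u x) ⟩
          orbit u x                         ∎
        (no xᵤ≢c) → ℤₚ.≤-reflexive (orbit-rests x u<m (orbit-avoids x x≢c₀ (ℕₚ.<⇒≤ u<m)) xᵤ≢c)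
      where open ℤₚ.≤-Reasoning

    orbit-antitone : ∀ x → ¬ x ≡[mod n ] c 0 → ∀ {s t} → s ≤ t → t ≤ m → orbit t x ℤ.≤ orbit s x
    orbit-antitone x x≢c₀ s≤t t≤m = chain (Flip.preorder ℤₚ.≤-preorder) (λ u → orbit u x)
      (λ u u<t → orbit-descends x x≢c₀ (ℕₚ.<-≤-trans u<t t≤m)) (ℕₚ.≤⇒≤′ s≤t)

    c₀-divisible : + n ∣ c 0
    c₀-divisible = decidable-stable (+ n ∣? c 0) λ n∤c₀ → ℤₚ.<-irrefl refl (begin-strict
      c 0              ≤⟨ chain ℤₚ.≤-preorder c (λ u u<m → ℤₚ.<⇒≤ (increasing u u<m)) (ℕₚ.≤⇒≤′ (z≤n {m})) ⟩
      c m              ≡⟨ ℤₚ.+-identityʳ (c m) ⟨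
      c m + 0ℤ         <⟨ ℤₚ.+-monoʳ-< (c m) (ℤ.+<+ (s≤s z≤n)) ⟩
      c m + + n        ≡⟨ cong (_+ + n) (orbit-c₀ ℕₚ.≤-refl) ⟨
      orbit m (c 0) + + n ≡⟨ revProdR-end-∤ n∤c₀ ⟩
      c 0              ∎)
      where open ℤₚ.≤-Reasoning

    step<n : ∀ u → u < m → ∣ c (suc u) - c u ∣ < n
    step<n u u<m = i<j<i+n⇒∣j-i∣<n (increasing u u<m) (ℤₚ.≤∧≢⇒< cₛ≤cᵤ+n cₛ≢cᵤ+n)
      where
      x = source u
      x≢c₀ = source≢c₀ u<m
      n∤x : ¬ + n ∣ x
      n∤x n∣x = x≢c₀ (∣m∣n⇒∣m-n n∣x c₀-divisible)
      open ℤₚ.≤-Reasoning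
      cₛ≤cᵤ+n : c (suc u) ℤ.≤ c u + + n
      cₛ≤cᵤ+n = begin
        c (suc u)                   ≡⟨ orbit-source u<m ⟨
        orbit u x                   ≤⟨ orbit-antitone x x≢c₀ z≤n (ℕₚ.<⇒≤ u<m) ⟩
        x                           ≡⟨ revProdR-end-∤ n∤x ⟨
        orbit m x + + n             ≤⟨ ℤₚ.+-monoˡ-≤ (+ n) (orbit-antitone x x≢c₀ u<m ℕₚ.≤-refl) ⟩
        orbit (suc u) x + + n       ≡⟨ cong (_+ + n) (orbit-source-step u<m) ⟩
        c u + + n                   ∎
      cₛ≢cᵤ+n : c (suc u) ≢ c u + + n
      cₛ≢cᵤ+n cₛ≡cᵤ+n = apart u u<m (subst (c u ≡[mod n ]_) (sym cₛ≡cᵤ+n) (≡mod-+-multiple (c u) ∣-refl))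

  module Bounded (1≤B : 1 ≤ B) {c : ℕ → ℤ} (path : IsPath n r m c)
                 (bounded : ∀ u → u < m → ∣ c (suc u) - c u ∣ < n) where

    open Path {r = r} reflections path

    Hits : ℕ → ℤ → Set
    Hits u x = orbit u x ≡[mod n ] c u ⊎ orbit u x ≡[mod n ] c (suc u)

    hits? : ∀ u x → Dec (Hits u x)
    hits? u x = (orbit u x ≡[mod n ]? c u) ⊎-dec (orbit u x ≡[mod n ]? c (suc u))

    jumps : ℕ → ℤ → ℕ
    jumps t x = ∑[ u < t ] 𝟙 (does (hits? u x))

    orbit-step≤ : ∀ {u} → u < m → ∀ x → ∣ orbit (suc u) x - orbit u x ∣ ≤ B ℕ.* 𝟙 (does (hits? u x))
    orbit-step≤ {u} u<m x = case hits? u x of λ where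
        (yes hit) → begin
          ∣ orbit (suc u) x - orbit u x ∣                        ≡⟨ cong (λ y → ∣ y - orbit u x ∣) (orbit-step u<m x) ⟩
          ∣ aref n (c u) (c (suc u)) (orbit u x) - orbit u x ∣   ≤⟨ aref-moves≤ {n} {c u} {c (suc u)} (orbit u x) ⟩
          ∣ c (suc u) - c u ∣                                    ≤⟨ ℕₚ.<⇒≤pred (bounded u u<m) ⟩
          B                                                      ≡⟨ ℕₚ.*-identityʳ B ⟨
          B ℕ.* 1                                                ≡⟨ cong (λ b → B ℕ.* 𝟙 b) (dec-true (hits? u x) hit) ⟨
          B ℕ.* 𝟙 (does (hits? u x))                             ∎
        (no miss) → begin
          ∣ orbit (suc u) x - orbit u x ∣                        ≡⟨ cong (λ y → ∣ y - orbit u x ∣) (rests miss) ⟩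
          ∣ orbit u x - orbit u x ∣                              ≡⟨ cong ∣_∣ (ℤₚ.+-inverseʳ (orbit u x)) ⟩
          0                                                      ≡⟨ ℕₚ.*-zeroʳ B ⟨
          B ℕ.* 0                                                ≡⟨ cong (λ b → B ℕ.* 𝟙 b) (dec-false (hits? u x) miss) ⟨
          B ℕ.* 𝟙 (does (hits? u x))                             ∎
      where
      open ℕₚ.≤-Reasoning
      rests : ¬ Hits u x → orbit (suc u) x ≡ orbit u x
      rests miss = orbit-rests x u<m (miss ∘ inj₁) (miss ∘ inj₂)

    orbit-displacement : ∀ x {s t} → s ≤ t → t ≤ m → ∣ orbit t x - orbit s x ∣ ℕ.+ B ℕ.* jumps s x ≤ B ℕ.* jumps t x
    orbit-displacement x s≤t t≤m =
      walk-bound (λ u → orbit u x) (λ u → 𝟙 (does (hits? u x))) B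
        (λ u u<t → orbit-step≤ (ℕₚ.<-≤-trans u<t t≤m) x) (ℕₚ.≤⇒≤′ s≤t)

    orbit-displacement₀ : ∀ x {t} → t ≤ m → ∣ orbit t x - x ∣ ≤ B ℕ.* jumps t x
    orbit-displacement₀ x {t} t≤m = begin
      ∣ orbit t x - x ∣                        ≤⟨ ℕₚ.m≤m+n ∣ orbit t x - x ∣ 0 ⟩
      ∣ orbit t x - x ∣ ℕ.+ 0                  ≡⟨ cong (∣ orbit t x - x ∣ ℕ.+_) (ℕₚ.*-zeroʳ B) ⟨
      ∣ orbit t x - x ∣ ℕ.+ B ℕ.* jumps 0 x    ≤⟨ orbit-displacement x z≤n t≤m ⟩
      B ℕ.* jumps t x                          ∎
      where open ℕₚ.≤-Reasoning

    jumps-c₀ : ∀ {t} → t ≤ m → jumps t (c 0) ≡ t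
    jumps-c₀ {zero}  _   = refl
    jumps-c₀ {suc t} t<m = begin
      jumps t (c 0) ℕ.+ 𝟙 (does (hits? t (c 0)))   ≡⟨ cong₂ ℕ._+_ (jumps-c₀ (ℕₚ.<⇒≤ t<m)) c₀-hits ⟩
      t ℕ.+ 1                                       ≡⟨ ℕₚ.+-comm t 1 ⟩
      suc t                                         ∎
      where
      open ≡-Reasoning
      c₀-hits : 𝟙 (does (hits? t (c 0))) ≡ 1
      c₀-hits = cong 𝟙 (dec-true (hits? t (c 0))
        (inj₁ (subst (_≡[mod n ] c t) (sym (orbit-c₀ (ℕₚ.<⇒≤ t<m))) (≡mod-refl (c t)))))

    jumps-cong : ∀ t x y → x ≡[mod n ] y → jumps t x ≡ jumps t y
    jumps-cong t x y x≡y = ∑-cong t λ u → cong 𝟙 (does-⇔ (hits-⇔ u) (hits? u x) (hits? u y))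
      where
      hits-resp : ∀ u x y → x ≡[mod n ] y → Hits u x → Hits u y
      hits-resp u x y x≡y = Sum.map (≡mod-trans (orbit u y) (orbit u x) (c u) yᵤ≡xᵤ)
                                    (≡mod-trans (orbit u y) (orbit u x) (c (suc u)) yᵤ≡xᵤ)
        where yᵤ≡xᵤ = ≡mod-sym (orbit u x) (orbit u y) (revProdR-cong u x y x≡y)
      hits-⇔ : ∀ u → Hits u x ⇔ Hits u y
      hits-⇔ u = mk⇔ (hits-resp u x y x≡y) (hits-resp u y x (≡mod-sym x y x≡y))

    instance
      B-nonZero : ℕ.NonZero B
      B-nonZero = ℕ.>-nonZero 1≤B

    n≤jumps : ∀ {x} → + n ∣ x → n ≤ jumps m x
    n≤jumps {x} n∣x = ℕₚ.*-cancelˡ-≤ B (begin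
      B ℕ.* n                          ≡⟨ ℕₚ.*-comm B n ⟩
      n ℕ.* B                          ≡⟨ cong ∣_∣ (ℤₚ.pos-* n B) ⟩
      ∣ + n * + B ∣                    ≡⟨ cong ∣_∣ (i-[i-k]≡k (orbit m x) (+ n * + B)) ⟨
      ∣ orbit m x - (orbit m x - + n * + B) ∣ ≡⟨ cong (λ y → ∣ orbit m x - y ∣) (revProdR-end-∣ n∣x) ⟩
      ∣ orbit m x - x ∣                ≤⟨ orbit-displacement₀ x ℕₚ.≤-refl ⟩
      B ℕ.* jumps m x                  ∎)
      where open ℕₚ.≤-Reasoning

    end-displacement-∤ : ∀ {x} → ¬ + n ∣ x → ∣ orbit m x - x ∣ ≡ n
    end-displacement-∤ {x} n∤x = begin
      ∣ orbit m x - x ∣                  ≡⟨ cong (λ z → ∣ orbit m x - z ∣) (revProdR-end-∤ n∤x) ⟨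
      ∣ orbit m x - (orbit m x + + n) ∣  ≡⟨ cong ∣_∣ (i-[i+k]≡-k (orbit m x) (+ n)) ⟩
      ∣ - + n ∣                          ≡⟨ ℤₚ.∣-i∣≡∣i∣ (+ n) ⟩
      n                                  ∎
      where open ≡-Reasoning

    two≤jumps : ∀ x → 2 ≤ jumps m x
    two≤jumps x = case + n ∣? x of λ where
        (yes n∣x) → ℕₚ.≤-trans (s≤s 1≤B) (n≤jumps n∣x)
        (no n∤x)  → ℕₚ.≮⇒≥ λ jumps<2 → ℕₚ.<-irrefl refl (begin
          n                    ≡⟨ end-displacement-∤ n∤x ⟨
          ∣ orbit m x - x ∣    ≤⟨ orbit-displacement₀ x ℕₚ.≤-refl ⟩
          B ℕ.* jumps m x      ≤⟨ ℕₚ.*-monoʳ-≤ B (ℕₚ.≤-pred jumps<2) ⟩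
          B ℕ.* 1              ≡⟨ ℕₚ.*-identityʳ B ⟩
          B                    ∎)
      where open ℕₚ.≤-Reasoning

    -- Representatives of the classes mod n, numbered so that the class of c 0 is the last
    -- summand of ∑[ i < n ].
    rep : ℕ → ℤ
    rep i = (c 0 - + B) + + i

    jumps-rep-B : jumps m (rep B) ≡ m
    jumps-rep-B = trans (cong (jumps m) ([i-k]+k≡i (c 0) (+ B))) (jumps-c₀ ℕₚ.≤-refl)

    ∑-hits≤2 : ∀ u → u < m → ∑[ i < n ] 𝟙 (does (hits? u (rep i))) ≤ 2
    ∑-hits≤2 u u<m = begin
      ∑[ i < n ] 𝟙 (does (hits? u (rep i)))    ≤⟨ ∑-mono-≤ n (λ i _ → 𝟙-∨ (does (visits? (c u) i)) _) ⟩
      ∑[ i < n ] (visits (c u) i ℕ.+ visits (c (suc u)) i)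
                                               ≡⟨ ∑-distrib-+ n (visits (c u)) (visits (c (suc u))) ⟩
      ∑ n (visits (c u)) ℕ.+ ∑ n (visits (c (suc u)))
                                               ≤⟨ ℕₚ.+-mono-≤ (∑-𝟙-unique n (visits? (c u)) (unique (c u)))
                                                             (∑-𝟙-unique n (visits? (c (suc u))) (unique (c (suc u)))) ⟩
      2                                        ∎
      where
      open ℕₚ.≤-Reasoning
      visits? : ∀ p i → Dec (orbit u (rep i) ≡[mod n ] p)
      visits? p i = orbit u (rep i) ≡[mod n ]? p
      visits : ℤ → ℕ → ℕ
      visits p i = 𝟙 (does (visits? p i))
      unique : ∀ p i i′ → i < n → i′ < n → orbit u (rep i) ≡[mod n ] p → orbit u (rep i′) ≡[mod n ] p → i ≡ i′
      unique p i i′ i<n i′<n visitsᵢ visitsᵢ′ = residue-injective (c 0 - + B) i<n i′<n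
        (revProdR-cong⁻¹ reflections (ℕₚ.<⇒≤ u<m) (rep i) (rep i′)
          (≡mod-trans (orbit u (rep i)) p (orbit u (rep i′)) visitsᵢ (≡mod-sym (orbit u (rep i′)) p visitsᵢ′)))

    ∑-jumps-others≤ : ∑[ i < B ] jumps m (rep i) ≤ B ℕ.* 2
    ∑-jumps-others≤ = subst (∑[ i < B ] jumps m (rep i) ≤_) m≡B*2 (ℕₚ.+-cancelʳ-≤ m _ m (begin
      ∑[ i < B ] jumps m (rep i) ℕ.+ m    ≡⟨ cong (∑[ i < B ] jumps m (rep i) ℕ.+_) jumps-rep-B ⟨
      ∑[ i < n ] jumps m (rep i)          ≤⟨ ∑-swap-≤ n m (λ i u → 𝟙 (does (hits? u (rep i)))) ∑-hits≤2 ⟩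
      m ℕ.* 2                             ≡⟨ ℕₚ.*-comm m 2 ⟩
      m ℕ.+ (m ℕ.+ 0)                     ≡⟨ cong (m ℕ.+_) (ℕₚ.+-identityʳ m) ⟩
      m ℕ.+ m                             ∎))
      where open ℕₚ.≤-Reasoning

    jumps≤2 : ∀ x → ¬ x ≡[mod n ] c 0 → jumps m x ≤ 2
    jumps≤2 x x≢c₀ with residue (c 0 - + B) x
    ... | i , i<n , repᵢ≡x = begin
      jumps m x          ≡⟨ jumps-cong m (rep i) x repᵢ≡x ⟨
      jumps m (rep i)    ≤⟨ ∑-average B (λ i _ → two≤jumps (rep i)) ∑-jumps-others≤ i i<B ⟩
      2                  ∎
      where
      open ℕₚ.≤-Reasoning
      i<B : i < B
      i<B = ℕₚ.≤∧≢⇒< (ℕₚ.≤-pred i<n) λ i≡B → x≢c₀ (≡mod-sym (c 0) x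
        (subst (_≡[mod n ] x) (trans (cong rep i≡B) ([i-k]+k≡i (c 0) (+ B))) repᵢ≡x))

    -- The orbit of source u jumps by c u − c (suc u) at step u and by less than n at its only
    -- other jump, while λ_n⁻¹ moves it by −n.
    increasing-if-∣ : + n ∣ c 0 → ∀ u → u < m → c u ℤ.< c (suc u)
    increasing-if-∣ n∣c₀ u u<m = ∣i-[j+n]∣<n⇒j<i (begin-strict
      ∣ c (suc u) - (c u + + n) ∣    ≡⟨ cong ∣_∣ cₛ-[cᵤ+n]≡P+Q ⟩
      ∣ P + Q ∣                      ≤⟨ ℤₚ.∣i+j∣≤∣i∣+∣j∣ P Q ⟩
      ∣ P ∣ ℕ.+ ∣ Q ∣                <⟨ s≤s ∣P∣+∣Q∣≤B ⟩
      n                              ∎)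
      where
      open ℕₚ.≤-Reasoning
      x = source u
      x≢c₀ = source≢c₀ u<m
      n∤x : ¬ + n ∣ x
      n∤x n∣x = x≢c₀ (∣m∣n⇒∣m-n n∣x n∣c₀)
      P = orbit m x - c u
      Q = c (suc u) - x
      cₛ-[cᵤ+n]≡P+Q : c (suc u) - (c u + + n) ≡ P + Q
      cₛ-[cᵤ+n]≡P+Q = trans (s-[u+k]≡[y-u]+[s-[y+k]] (c (suc u)) (c u) (orbit m x) (+ n))
                            (cong (λ z → P + (c (suc u) - z)) (revProdR-end-∤ n∤x))
      jumps-at-u : jumps (suc u) x ≡ suc (jumps u x)
      jumps-at-u = trans (cong (λ b → jumps u x ℕ.+ 𝟙 b) (dec-true (hits? u x) (inj₂ xᵤ≡cₛ)))
                         (ℕₚ.+-comm (jumps u x) 1)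
        where xᵤ≡cₛ = subst (_≡[mod n ] c (suc u)) (sym (orbit-source u<m)) (≡mod-refl (c (suc u)))
      before : ∣ Q ∣ ≤ B ℕ.* jumps u x
      before = subst (λ y → ∣ y - x ∣ ≤ B ℕ.* jumps u x) (orbit-source u<m) (orbit-displacement₀ x (ℕₚ.<⇒≤ u<m))
      after : ∣ P ∣ ℕ.+ B ℕ.* jumps (suc u) x ≤ B ℕ.* jumps m x
      after = subst (λ y → ∣ orbit m x - y ∣ ℕ.+ B ℕ.* jumps (suc u) x ≤ B ℕ.* jumps m x)
                (orbit-source-step u<m) (orbit-displacement x u<m ℕₚ.≤-refl)
      ∣P∣+∣Q∣≤B : ∣ P ∣ ℕ.+ ∣ Q ∣ ≤ B
      ∣P∣+∣Q∣≤B = ℕₚ.+-cancelʳ-≤ B (∣ P ∣ ℕ.+ ∣ Q ∣) B (begin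
        ∣ P ∣ ℕ.+ ∣ Q ∣ ℕ.+ B                 ≤⟨ ℕₚ.+-monoˡ-≤ B (ℕₚ.+-monoʳ-≤ ∣ P ∣ before) ⟩
        ∣ P ∣ ℕ.+ B ℕ.* jumps u x ℕ.+ B       ≡⟨ ℕₚ.+-assoc ∣ P ∣ (B ℕ.* jumps u x) B ⟩
        ∣ P ∣ ℕ.+ (B ℕ.* jumps u x ℕ.+ B)     ≡⟨ cong (∣ P ∣ ℕ.+_) (ℕₚ.+-comm (B ℕ.* jumps u x) B) ⟩
        ∣ P ∣ ℕ.+ (B ℕ.+ B ℕ.* jumps u x)     ≡⟨ cong (∣ P ∣ ℕ.+_) (ℕₚ.*-suc B (jumps u x)) ⟨
        ∣ P ∣ ℕ.+ B ℕ.* suc (jumps u x)       ≡⟨ cong (λ j → ∣ P ∣ ℕ.+ B ℕ.* j) jumps-at-u ⟨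
        ∣ P ∣ ℕ.+ B ℕ.* jumps (suc u) x       ≤⟨ after ⟩
        B ℕ.* jumps m x                       ≤⟨ ℕₚ.*-monoʳ-≤ B (jumps≤2 x x≢c₀) ⟩
        B ℕ.* 2                               ≡⟨ ℕₚ.*-comm B 2 ⟩
        B ℕ.+ (B ℕ.+ 0)                       ≡⟨ cong (B ℕ.+_) (ℕₚ.+-identityʳ B) ⟩
        B ℕ.+ B                               ∎)

    B≡1-if-∤ : ¬ + n ∣ c 0 → B ≡ 1
    B≡1-if-∤ n∤c₀ = ℕₚ.≤-antisym (ℕₚ.≤-pred (ℕₚ.≤-trans (n≤jumps (divides 0ℤ refl)) (jumps≤2 0ℤ 0≢c₀))) 1≤B
      where
      0≢c₀ : ¬ 0ℤ ≡[mod n ] c 0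
      0≢c₀ 0≡c₀ = n∤c₀ (subst (+ n ∣_) (ℤₚ.+-identityʳ (c 0)) (≡mod-sym 0ℤ (c 0) 0≡c₀))

-- Tree-like and path-like factorizations

from-suc : ∀ {m} {P : ℕ → Set} → (∀ u → u < m → P (suc u)) → ∀ ℓ → 1 ≤ ℓ → ℓ ≤ m → P ℓ
from-suc h (suc u) _ u<m = h u u<m

module _ {n : ℕ} {r : RSeq} where

  private
    m = 2 ℕ.* n ℕ.∸ 2

  treeLike⇒increasingPath : TreeLike n r → ∃ λ c → IsPath n r m c × (∀ u → u < m → c u ℤ.< c (suc u))
  treeLike⇒increasingPath (a , b , tree , linked) = c , path , increasing
    where
    c : ℕ → ℤ
    c zero    = a 0
    c (suc u) = c u + (b (suc u) - a u)

    c≡a : ∀ u → u < m → c u ≡[mod n ] a u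
    c≡a zero    _     = ≡mod-refl (a 0)
    c≡a (suc u) 1+u<m = subst (+ n ∣_) (sym ([c+[b-a]]-a′≡[c-a]+[b-a′] (c u) (b (suc u)) (a u) (a (suc u))))
      (∣m∣n⇒∣m+n (c≡a u (ℕₚ.<⇒≤ 1+u<m)) (≡mod-sym (a (suc u)) (b (suc u)) (linked (suc u) (s≤s z≤n) 1+u≤2n∸3)))
      where
      1+u≤2n∸3 : suc u ≤ 2 ℕ.* n ℕ.∸ 3
      1+u≤2n∸3 = subst (suc u ≤_) (ℕₚ.∸-+-assoc (2 ℕ.* n) 2 1) (ℕₚ.<⇒≤pred 1+u<m)

    cᵤ≡aᵤ+K : ∀ u → c u ≡ a u + (c u - a u)
    cᵤ≡aᵤ+K u = sym (i+[j-i]≡j (a u) (c u))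

    cₛ≡bₛ+K : ∀ u → c (suc u) ≡ b (suc u) + (c u - a u)
    cₛ≡bₛ+K u = j+[y-i]≡y+[j-i] (c u) (b (suc u)) (a u)

    path : IsPath n r m c
    path u u<m y = begin
      act n (r (suc u)) y                                     ≡⟨ proj₁ (tree (suc u) (s≤s z≤n) u<m) y ⟩
      aref n (a u) (b (suc u)) y                              ≡⟨ aref-translate (c≡a u u<m) y ⟨
      aref n (a u + (c u - a u)) (b (suc u) + (c u - a u)) y  ≡⟨ cong₂ (λ i j → aref n i j y) (cᵤ≡aᵤ+K u) (cₛ≡bₛ+K u) ⟨
      aref n (c u) (c (suc u)) y                              ∎
      where open ≡-Reasoning

    increasing : ∀ u → u < m → c u ℤ.< c (suc u)
    increasing u u<m = subst₂ ℤ._<_ (sym (cᵤ≡aᵤ+K u)) (sym (cₛ≡bₛ+K u))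
      (ℤₚ.+-monoˡ-< (c u - a u) (proj₂ (tree (suc u) (s≤s z≤n) u<m)))

  increasingPath⇒treeLike : ∀ {c} → IsPath n r m c → (∀ u → u < m → c u ℤ.< c (suc u)) → TreeLike n r
  increasingPath⇒treeLike {c} path increasing =
    c , c , from-suc (λ u u<m → path u u<m , increasing u u<m) , λ k _ _ → ≡mod-refl (c k)

  decreasingPath⇒treeLike : ∀ {c} → Reflections n r m → IsPath n r m c → (∀ u → u < m → c (suc u) ℤ.< c u) →
                            (∀ k → 1 ≤ k → k ≤ 2 ℕ.* n ℕ.∸ 3 → c (suc k) ≡[mod n ] c (k ℕ.∸ 1)) → TreeLike n r
  decreasingPath⇒treeLike {c} reflections path decreasing alternating =
    (λ k → c (suc k)) , (λ k → c (k ℕ.∸ 1)) ,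
    from-suc (λ u u<m → (λ y → trans (path u u<m y) (aref-comm (apart u u<m) y)) , decreasing u u<m) ,
    alternating
    where open Path {r = r} reflections path using (apart)

module _ {B : ℕ} {r : RSeq} (hmin : IsMinReflFact (suc B) r) where

  open Factorization hmin

  treeLike⇒pathLike : TreeLike n r → PathLike n r
  treeLike⇒pathLike tree with treeLike⇒increasingPath tree
  ... | c , path , increasing = c , from-suc (λ u u<m → path u u<m , step<n u u<m)
    where open Increasing path increasing

  treeLike-for-n≡2 : B ≡ 1 → ∀ {c} → IsPath n r m c → (∀ u → u < m → ∣ c (suc u) - c u ∣ < n) →
                     ¬ + n ∣ c 0 → TreeLike n r
  treeLike-for-n≡2 refl {c} path bounded n∤c₀ = decreasingPath⇒treeLike reflections path decreasing alternating
    where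
    open Path {r = r} reflections path using (orbit-c₀)
    c₂+2≡c₀ : c 2 + + 2 ≡ c 0
    c₂+2≡c₀ = trans (cong (_+ + 2) (sym (orbit-c₀ ℕₚ.≤-refl))) (revProdR-end-∤ n∤c₀)
    decreasing : ∀ u → u < 2 → c (suc u) ℤ.< c u
    decreasing 0 _ = subst (c 1 ℤ.<_) c₂+2≡c₀
      (∣i-j∣<n⇒i<j+n (subst (_< 2) (ℤₚ.∣i-j∣≡∣j-i∣ (c 2) (c 1)) (bounded 1 ℕₚ.≤-refl)))
    decreasing 1 _ = ∣i-[j+n]∣<n⇒j<i (subst (λ c₀ → ∣ c 1 - c₀ ∣ < 2) (sym c₂+2≡c₀) (bounded 0 (s≤s z≤n)))
    decreasing (suc (suc _)) (s≤s (s≤s ()))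
    alternating : ∀ k → 1 ≤ k → k ≤ 1 → c (suc k) ≡[mod 2 ] c (k ℕ.∸ 1)
    alternating 1 _ _ = subst (c 2 ≡[mod 2 ]_) c₂+2≡c₀ (≡mod-+-multiple (c 2) ∣-refl)
    alternating (suc (suc _)) _ (s≤s ())

  pathLike⇒treeLike : 1 ≤ B → PathLike n r → TreeLike n r
  pathLike⇒treeLike 1≤B (c , pathLike) = case + n ∣? c 0 of λ where
      (yes n∣c₀) → increasingPath⇒treeLike path (increasing-if-∣ n∣c₀)
      (no n∤c₀)  → treeLike-for-n≡2 (B≡1-if-∤ n∤c₀) path bounded n∤c₀
    where
    path : IsPath n r m c
    path u u<m = proj₁ (pathLike (suc u) (s≤s z≤n) u<m)
    bounded : ∀ u → u < m → ∣ c (suc u) - c u ∣ < n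
    bounded u u<m = proj₂ (pathLike (suc u) (s≤s z≤n) u<m)
    open Bounded 1≤B path bounded

proposition3p4 : (n : ℕ) → 2 ≤ n → (r : RSeq) → IsMinReflFact n r →
    TreeLike n r ⇔ PathLike n r
proposition3p4 (suc B) (s≤s 1≤B) r hmin = mk⇔ (treeLike⇒pathLike hmin) (pathLike⇒treeLike hmin 1≤B)
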